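{- There exist constants $c,c'>0$ such that for all $m,n\ge1$ there exists a 2D string $\mathcal{M}$ with $m$ rows and $n$ columns such that $\delta(\mathcal{M})\le c$ (i.e. $\delta(\mathcal{M})=O(1)$) and $\gamma(\mathcal{M})\ge c'\min(m,n)$ (i.e. $\gamma(\mathcal{M})=\Omega(\min(m,n))$).
   Context: A 2D string $\mathcal{M}$ with $m$ rows and $n$ columns is an $m\times n$ matrix over a finite alphabet $\Sigma$. $\mathcal{M}[i_1..i_2][j_1..j_2]$ denotes the submatrix (factor) with top-left corner $(i_1,j_1)$ and bottom-right corner $(i_2,j_2)$. $P_\mathcal{M}(k_1,k_2)$ is the number of distinct $k_1\times k_2$ factors of $\mathcal{M}$, and $\delta(\mathcal{M})=\max\{P_\mathcal{M}(k_1,k_2)/(k_1k_2): 1\le k_1\le m, 1\le k_2\le n\}$. An attractor of $\mathcal{M}$ is a set $\Gamma\subseteq[1..m]\times[1..n]$ such that every factor $\mathcal{M}[i..j][k..l]$ has an occurrence $\mathcal{M}[i'..j'][k'..l']$ (an equal submatrix) for which some $(x,y)\in\Gamma$ satisfies $i'\le x\le j'$ and $k'\le y\le l'$. $\gamma(\mathcal{M})$ is the size of a smallest attractor. -}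

module Defs where

open import Data.Nat using (ℕ; zero; suc; _+_; _*_; _∸_; _≤_; _<_; _≤?_; _⊓_)
open import Data.Nat.Properties using (+-monoʳ-<; ≤-trans; m∸n+n≡m; +-comm; +-monoˡ-≤; ≤-pred)
open import Data.Fin using (Fin; toℕ; fromℕ<)
open import Data.Fin.Properties using (toℕ<n; toℕ≤pred[n])
open import Data.Vec using (Vec; tabulate)
open import Data.Vec.Properties using (≡-dec)
open import Data.Fin.Properties using () renaming (_≟_ to _≟F_)
open import Data.List using (List; length; map; concatMap; allFin; deduplicate)
open import Data.Nat.ListAction using (sum)
open import Data.Bool using (Bool; true; false; T; if_then_else_)
open import Data.Product using (Σ; ∃; _×_; _,_)
open import Relation.Binary.PropositionalEquality using (_≡_; subst)
open import Relation.Nullary using (yes; no)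

Matrix : Set → ℕ → ℕ → Set
Matrix A m n = Fin m → Fin n → A

shift : ∀ {m} (r h : ℕ) → r + h ≤ m → Fin h → Fin m
shift r h p a = fromℕ< (≤-trans (+-monoʳ-< r (toℕ<n a)) p)

factor : ∀ {A m n} → Matrix A m n → (r c h w : ℕ) →
         r + h ≤ m → c + w ≤ n → Vec (Vec A w) h
factor M r c h w p q =
  tabulate λ a → tabulate λ b → M (shift r h p a) (shift c w q b)

private
  valid : ∀ {m} (h : ℕ) → h ≤ m → (r : Fin (suc (m ∸ h))) → toℕ r + h ≤ m
  valid {m} h h≤m r =
    subst (toℕ r + h ≤_) (m∸n+n≡m h≤m) (+-monoˡ-≤ h (toℕ≤pred[n] r))

-- P_M(h , w): the number of distinct h × w factors of M
-- (over a finite alphabet Fin σ, so equality of factors is decidable).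
P : ∀ {σ m n} → Matrix (Fin σ) m n → ℕ → ℕ → ℕ
P {σ} {m} {n} M h w with h ≤? m | w ≤? n
... | yes h≤m | yes w≤n =
  length (deduplicate (≡-dec (≡-dec _≟F_))
    (concatMap (λ r → map (λ c → factor M (toℕ r) (toℕ c) h w
                                   (valid h h≤m r) (valid w w≤n c))
                          (allFin (suc (n ∸ w))))
               (allFin (suc (m ∸ h)))))
... | _ | _ = 0

-- δ(M) ≤ c  (δ(M) = max over 1 ≤ k₁ ≤ m, 1 ≤ k₂ ≤ n of P_M(k₁,k₂)/(k₁k₂))
δ≤ : ∀ {σ m n} → Matrix (Fin σ) m n → ℕ → Set
δ≤ {σ} {m} {n} M c =
  ∀ k₁ k₂ → 1 ≤ k₁ → k₁ ≤ m → 1 ≤ k₂ → k₂ ≤ n → P M k₁ k₂ ≤ c * (k₁ * k₂)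

Positions : ℕ → ℕ → Set
Positions m n = Fin m → Fin n → Bool

size : ∀ {m n} → Positions m n → ℕ
size {m} {n} Γ =
  sum (map (λ i → sum (map (λ j → if Γ i j then 1 else 0) (allFin n))) (allFin m))

IsAttractor : ∀ {A m n} → Matrix A m n → Positions m n → Set
IsAttractor {A} {m} {n} M Γ =
  ∀ r c h w → 1 ≤ h → 1 ≤ w → (p : r + h ≤ m) → (q : c + w ≤ n) →
  Σ ℕ λ r′ → Σ ℕ λ c′ → Σ (r′ + h ≤ m) λ p′ → Σ (c′ + w ≤ n) λ q′ →
    (factor M r′ c′ h w p′ q′ ≡ factor M r c h w p q) ×
    Σ (Fin m) λ x → Σ (Fin n) λ y →
      T (Γ x y) × (r′ ≤ toℕ x) × (toℕ x < r′ + h) × (c′ ≤ toℕ y) × (toℕ y < c′ + w)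

-- γ(M) ≥ (a / b) · N, i.e. every attractor Γ of M satisfies a · N ≤ b · |Γ|
-- (equivalently, a smallest attractor has size at least (a/b)·N).
γ≥ : ∀ {A m n} → Matrix A m n → (a b N : ℕ) → Set
γ≥ {A} {m} {n} M a b N = (Γ : Positions m n) → IsAttractor M Γ → a * N ≤ b * size Γ

-- Take the m × n matrix with 1s on the main diagonal.  An h × w window at (r , c) sees
-- only the offset c − r of the diagonal, and every offset outside a range of h + w + 1
-- values gives the zero window, so P(h , w) ≤ h + w + 1 ≤ 3hw.  For i < min(m , n), the
-- full-width factor formed by row i has its only 1 in column i, so it occurs at row i
-- alone; hence every attractor meets each of these min(m , n) rows.
{-# OPTIONS --safe #-}
module Submission where

open import Defs
open import Data.Bool using (Bool; true; false; T; if_then_else_)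
open import Data.Fin using (Fin; suc; toℕ; fromℕ<)
open import Data.Fin.Patterns using (0F; 1F)
open import Data.Fin.Properties using (toℕ<n; toℕ-fromℕ<; toℕ-injective; toℕ≤pred[n]) renaming (_≟_ to _≟F_)
open import Data.List using (List; []; _∷_; _++_; length; map; concatMap; allFin; tabulate; upTo; deduplicate)
open import Data.List.Properties using (length-++-sucʳ; length-map; length-upTo; map-tabulate)
open import Data.List.Membership.Propositional using (_∈_)
open import Data.List.Membership.Propositional.Properties
  using (∈-∃++; ∈-++⁻; ∈-++⁺ˡ; ∈-++⁺ʳ; ∈-map⁺; ∈-upTo⁺; ∈-deduplicate⁻)
open import Data.List.Relation.Binary.Subset.Propositional using (_⊆_)
import Data.List.Relation.Unary.All as All
open import Data.List.Relation.Unary.All.Properties using (concat⁺; map⁺; tabulate⁺)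
open import Data.List.Relation.Unary.Any using (here; there)
open import Data.List.Relation.Unary.AllPairs using (_∷_)
open import Data.List.Relation.Unary.Unique.Propositional using (Unique)
open import Data.List.Relation.Unary.Unique.DecPropositional.Properties using (deduplicate-!)
open import Data.Nat using (ℕ; suc; _+_; _*_; _∸_; _≤_; _<_; _⊓_; _≟_; _≤?_; z≤n; s≤s)
open import Data.Nat.ListAction using (sum)
open import Data.Nat.Properties
open import Data.Nat.Tactic.RingSolver using (solve)
open import Data.Product using (Σ; ∃; _×_; _,_)
open import Data.Sum using (inj₁; inj₂)
open import Data.Vec as Vec using (Vec)
open import Data.Vec.Properties using (lookup∘tabulate; tabulate-cong; ≡-dec)
open import Function using (id; _∘_; _⇔_; mk⇔)
import Function.Properties.Equivalence as ⇔
open import Relation.Binary.PropositionalEquality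
open import Relation.Binary.Definitions using (DecidableEquality)
open import Relation.Nullary using (Dec; does; yes; no; contradiction)
open import Relation.Nullary.Decidable using (does-⇔; dec-true)

unique-⊆⇒length≤ : ∀ {A : Set} {xs ys : List A} → Unique xs → xs ⊆ ys → length xs ≤ length ys
unique-⊆⇒length≤ {xs = []} _ _ = z≤n
unique-⊆⇒length≤ {xs = x ∷ xs} (x∉xs ∷ xs!) xxs⊆ys
  with ys₁ , ys₂ , refl ← ∈-∃++ (xxs⊆ys (here refl)) = begin
    suc (length xs)           ≤⟨ s≤s (unique-⊆⇒length≤ xs! xs⊆ys₁ys₂) ⟩
    suc (length (ys₁ ++ ys₂)) ≡⟨ length-++-sucʳ ys₁ x ys₂ ⟨
    length (ys₁ ++ x ∷ ys₂)   ∎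
  where
  open ≤-Reasoning
  xs⊆ys₁ys₂ : xs ⊆ ys₁ ++ ys₂
  xs⊆ys₁ys₂ y∈xs with ∈-++⁻ ys₁ (xxs⊆ys (there y∈xs))
  ... | inj₁ y∈ys₁        = ∈-++⁺ˡ y∈ys₁
  ... | inj₂ (here refl)  = contradiction refl (All.lookup x∉xs y∈xs)
  ... | inj₂ (there y∈ys₂) = ∈-++⁺ʳ ys₁ y∈ys₂

distinct-grid≤length : ∀ {A : Set} (_≟_ : DecidableEquality A) {a b} (F : Fin a → Fin b → A)
                       {L : List A} → (∀ r c → F r c ∈ L) →
                       length (deduplicate _≟_ (concatMap (λ r → map (F r) (allFin b)) (allFin a)))
                         ≤ length L
distinct-grid≤length _≟_ F F∈L = unique-⊆⇒length≤ (deduplicate-! _≟_ _)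
  (All.lookup (concat⁺ (map⁺ (tabulate⁺ λ r → map⁺ (tabulate⁺ (F∈L r))))) ∘ ∈-deduplicate⁻ _≟_ _)

-- `P` uses its own private proofs that the windows fit; `fits` is interchangeable with
-- them because `shift` passes such proofs only to `fromℕ<`, whose bound is irrelevant.
fits : ∀ {h m} → h ≤ m → (r : Fin (suc (m ∸ h))) → toℕ r + h ≤ m
fits {h} h≤m r = ≤-trans (+-monoˡ-≤ h (toℕ≤pred[n] r)) (≤-reflexive (m∸n+n≡m h≤m))

P≤length : ∀ {σ m n h w} (M : Matrix (Fin σ) m n) (L : List (Vec (Vec (Fin σ) w) h)) →
           (∀ r c (p : r + h ≤ m) (q : c + w ≤ n) → factor M r c h w p q ∈ L) →
           P M h w ≤ length L
P≤length {m = m} {n} {h} {w} M L factor∈L with h ≤? m | w ≤? n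
... | yes h≤m | yes w≤n = distinct-grid≤length (≡-dec (≡-dec _≟F_))
  (λ r c → factor M (toℕ r) (toℕ c) h w (fits h≤m r) (fits w≤n c))
  (λ r c → factor∈L _ _ (fits h≤m r) (fits w≤n c))
... | yes _   | no _    = z≤n
... | no _    | _       = z≤n

term≤sum-tabulate : ∀ {n} (g : Fin n → ℕ) i → g i ≤ sum (tabulate g)
term≤sum-tabulate g 0F      = m≤m+n _ _
term≤sum-tabulate g (suc i) = ≤-trans (term≤sum-tabulate (g ∘ suc) i) (m≤n+m _ (g 0F))

prefix≤sum-tabulate : ∀ {m} k (g : Fin m → ℕ) → k ≤ m → (∀ i → toℕ i < k → 1 ≤ g i) →
                      k ≤ sum (tabulate g)
prefix≤sum-tabulate 0       g _         _        = z≤n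
prefix≤sum-tabulate (suc k) g (s≤s k≤m) positive =
  +-mono-≤ (positive 0F (s≤s z≤n)) (prefix≤sum-tabulate k (g ∘ suc) k≤m (λ i → positive (suc i) ∘ s≤s))

sum-map-allFin : ∀ {n} (g : Fin n → ℕ) → sum (map g (allFin n)) ≡ sum (tabulate g)
sum-map-allFin g = cong sum (map-tabulate id g)

1≤if : ∀ {b} → T b → 1 ≤ (if b then 1 else 0)
1≤if {true}  _  = ≤-refl
1≤if {false} ()

occupied-rows≤size : ∀ {m n} (Γ : Positions m n) k → k ≤ m →
                     (∀ i → toℕ i < k → ∃ λ j → T (Γ i j)) → k ≤ size Γ
occupied-rows≤size {n = n} Γ k k≤m occupied = begin
  k                      ≤⟨ prefix≤sum-tabulate k rowSize k≤m rowSize≥1 ⟩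
  sum (tabulate rowSize) ≡⟨ sum-map-allFin rowSize ⟨
  size Γ                 ∎
  where
  open ≤-Reasoning
  indicator : Fin _ → Fin n → ℕ
  indicator i j = if Γ i j then 1 else 0
  rowSize : Fin _ → ℕ
  rowSize i = sum (map (indicator i) (allFin n))
  rowSize≥1 : ∀ i → toℕ i < k → 1 ≤ rowSize i
  rowSize≥1 i i<k with j , Γij ← occupied i i<k = begin
    1                            ≤⟨ 1≤if Γij ⟩
    indicator i j                ≤⟨ term≤sum-tabulate (indicator i) j ⟩
    sum (tabulate (indicator i)) ≡⟨ sum-map-allFin (indicator i) ⟨
    rowSize i                    ∎

toℕ-shift : ∀ {m} r h (p : r + h ≤ m) a → toℕ (shift r h p a) ≡ r + toℕ a
toℕ-shift r h p a = toℕ-fromℕ< _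

toℕ+1≤n : ∀ {n} (i : Fin n) → toℕ i + 1 ≤ n
toℕ+1≤n {n} i = subst (_≤ n) (+-comm 1 (toℕ i)) (toℕ<n i)

lookup-factor : ∀ {A m n} (M : Matrix A m n) r c h w (p : r + h ≤ m) (q : c + w ≤ n) a b →
                Vec.lookup (Vec.lookup (factor M r c h w p q) a) b ≡ M (shift r h p a) (shift c w q b)
lookup-factor M r c h w p q a b = begin
  Vec.lookup (Vec.lookup (factor M r c h w p q) a) b
    ≡⟨ cong (λ row → Vec.lookup row b) (lookup∘tabulate _ a) ⟩
  Vec.lookup (Vec.tabulate (M (shift r h p a) ∘ shift c w q)) b
    ≡⟨ lookup∘tabulate _ b ⟩
  M (shift r h p a) (shift c w q b) ∎
  where open ≡-Reasoning

+-∸-offset-⇔ : ∀ {a b w} r c → b < w → (r + a ≡ c + b) ⇔ (a + w ≡ b + (c + w ∸ r))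
+-∸-offset-⇔ {a} {b} {w} r c b<w = mk⇔ to from
  where
  open ≡-Reasoning
  to : r + a ≡ c + b → a + w ≡ b + (c + w ∸ r)
  to eq = +-cancelʳ-≡ r _ _ (begin
    a + w + r                ≡⟨ solve (a ∷ w ∷ r ∷ []) ⟩
    r + a + w                ≡⟨ cong (_+ w) eq ⟩
    c + b + w                ≡⟨ solve (c ∷ b ∷ w ∷ []) ⟩
    b + (c + w)              ≡⟨ cong (b +_) (m∸n+n≡m r≤c+w) ⟨
    b + (c + w ∸ r + r)      ≡⟨ +-assoc b _ r ⟨
    b + (c + w ∸ r) + r      ∎)
    where
    r≤c+w : r ≤ c + w
    r≤c+w = ≤-trans (m≤m+n r a) (≤-trans (≤-reflexive eq) (+-monoʳ-≤ c (<⇒≤ b<w)))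
  from : a + w ≡ b + (c + w ∸ r) → r + a ≡ c + b
  from eq with r ≤? c + w
  ... | yes r≤c+w = +-cancelʳ-≡ w _ _ (begin
    r + a + w                ≡⟨ +-assoc r a w ⟩
    r + (a + w)              ≡⟨ cong (r +_) eq ⟩
    r + (b + (c + w ∸ r))    ≡⟨ +-comm r _ ⟩
    b + (c + w ∸ r) + r      ≡⟨ +-assoc b _ r ⟩
    b + (c + w ∸ r + r)      ≡⟨ cong (b +_) (m∸n+n≡m r≤c+w) ⟩
    b + (c + w)              ≡⟨ solve (b ∷ c ∷ w ∷ []) ⟩
    c + b + w                ∎)
  ... | no r≰c+w = contradiction (<-≤-trans b<w (m≤n+m w a)) (<-irrefl (sym a+w≡b))
    where
    a+w≡b : a + w ≡ b
    a+w≡b = trans eq (trans (cong (b +_) (m≤n⇒m∸n≡0 (<⇒≤ (≰⇒> r≰c+w)))) (+-identityʳ b))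

+-⊓-clamp-⇔ : ∀ {x k} b e → x < k → (x ≡ b + e) ⇔ (x ≡ b + e ⊓ k)
+-⊓-clamp-⇔ {x} {k} b e x<k =
  mk⇔ (λ eq → trans eq (cong (b +_) (sym (e≤k⇒e⊓k≡e eq))))
      (λ eq → trans eq (cong (b +_) (e⊓k≡e eq)))
  where
  e≤k⇒e⊓k≡e : x ≡ b + e → e ⊓ k ≡ e
  e≤k⇒e⊓k≡e eq = m≤n⇒m⊓n≡m (≤-trans (m≤n+m e b) (≤-trans (≤-reflexive (sym eq)) (<⇒≤ x<k)))
  e⊓k≡e : x ≡ b + e ⊓ k → e ⊓ k ≡ e
  e⊓k≡e eq with ⊓-sel e k
  ... | inj₁ e⊓k≡e = e⊓k≡e
  ... | inj₂ e⊓k≡k = contradiction x<k (≤⇒≯ (begin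
    k         ≡⟨ e⊓k≡k ⟨
    e ⊓ k     ≤⟨ m≤n+m _ b ⟩
    b + e ⊓ k ≡⟨ eq ⟨
    x         ∎))
    where open ≤-Reasoning

fromBool : Bool → Fin 2
fromBool false = 0F
fromBool true  = 1F

fromBool-does⁻ : ∀ {A : Set} (a? : Dec A) → fromBool (does a?) ≡ 1F → A
fromBool-does⁻ (yes a) _  = a
fromBool-does⁻ (no _)  ()

diagonal : (m n : ℕ) → Matrix (Fin 2) m n
diagonal m n i j = fromBool (does (toℕ i ≟ toℕ j))

diagonal-shift : ∀ {m n} r c h w (p : r + h ≤ m) (q : c + w ≤ n) a b →
                 diagonal m n (shift r h p a) (shift c w q b) ≡ fromBool (does (r + toℕ a ≟ c + toℕ b))
diagonal-shift r c h w p q a b =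
  cong₂ (λ x y → fromBool (does (x ≟ y))) (toℕ-shift r h p a) (toℕ-shift c w q b)

lookup-factor-diagonal : ∀ {m n} r c h w (p : r + h ≤ m) (q : c + w ≤ n) a b →
                         Vec.lookup (Vec.lookup (factor (diagonal m n) r c h w p q) a) b
                           ≡ fromBool (does (r + toℕ a ≟ c + toℕ b))
lookup-factor-diagonal r c h w p q a b =
  trans (lookup-factor (diagonal _ _) r c h w p q a b) (diagonal-shift r c h w p q a b)

-- The window at (r , c) is `diagonalBlock h w d` for d = (c + w ∸ r) ⊓ (h + w): the
-- offset c − r shifted by w and clamped to [0 , h + w], beyond which the window is zero.
diagonalBlock : (h w d : ℕ) → Vec (Vec (Fin 2) w) h
diagonalBlock h w d = Vec.tabulate λ a → Vec.tabulate λ b → fromBool (does (toℕ a + w ≟ toℕ b + d))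

factor-diagonal : ∀ {m n} r c h w (p : r + h ≤ m) (q : c + w ≤ n) →
                  factor (diagonal m n) r c h w p q ≡ diagonalBlock h w ((c + w ∸ r) ⊓ (h + w))
factor-diagonal r c h w p q = tabulate-cong λ a → tabulate-cong λ b →
  trans (diagonal-shift r c h w p q a b) (cong fromBool (does-⇔ (offset-⇔ a b) (_ ≟ _) (_ ≟ _)))
  where
  offset-⇔ : (a : Fin h) (b : Fin w) →
             (r + toℕ a ≡ c + toℕ b) ⇔ (toℕ a + w ≡ toℕ b + (c + w ∸ r) ⊓ (h + w))
  offset-⇔ a b = ⇔.trans (+-∸-offset-⇔ r c (toℕ<n b))
                         (+-⊓-clamp-⇔ (toℕ b) (c + w ∸ r) (+-monoˡ-< w (toℕ<n a)))

P-diagonal≤ : ∀ m n h w → P (diagonal m n) h w ≤ suc (h + w)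
P-diagonal≤ m n h w = begin
  P (diagonal m n) h w        ≤⟨ P≤length (diagonal m n) blocks block∈blocks ⟩
  length blocks               ≡⟨ length-map (diagonalBlock h w) (upTo (suc (h + w))) ⟩
  length (upTo (suc (h + w))) ≡⟨ length-upTo (suc (h + w)) ⟩
  suc (h + w)                 ∎
  where
  open ≤-Reasoning
  blocks : List (Vec (Vec (Fin 2) w) h)
  blocks = map (diagonalBlock h w) (upTo (suc (h + w)))
  block∈blocks : ∀ r c (p : r + h ≤ m) (q : c + w ≤ n) → factor (diagonal m n) r c h w p q ∈ blocks
  block∈blocks r c p q rewrite factor-diagonal r c h w p q =
    ∈-map⁺ (diagonalBlock h w) (∈-upTo⁺ (s≤s (m⊓n≤n _ _)))

1+m+n≤3*m*n : ∀ {m n} → 1 ≤ m → 1 ≤ n → suc (m + n) ≤ 3 * (m * n)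
1+m+n≤3*m*n {suc m} {suc n} _ _ =
  +-mono-≤ (s≤s z≤n) (+-mono-≤ (m≤m*n (suc m) (suc n)) (≤-trans (m≤n*m (suc n) (suc m)) (m≤m+n _ 0)))

δ≤-diagonal : ∀ m n → δ≤ (diagonal m n) 3
δ≤-diagonal m n h w 1≤h _ 1≤w _ = ≤-trans (P-diagonal≤ m n h w) (1+m+n≤3*m*n 1≤h 1≤w)

diagonal-row-occurs-once : ∀ {m n} r r′ c′ (p : r + 1 ≤ m) (p′ : r′ + 1 ≤ m) (q′ : c′ + n ≤ n) →
                           r < n →
                           factor (diagonal m n) r′ c′ 1 n p′ q′ ≡ factor (diagonal m n) r 0 1 n p ≤-refl →
                           r′ ≡ r
diagonal-row-occurs-once {m} {n} r r′ c′ p p′ q′ r<n same = begin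
  r′            ≡⟨ +-identityʳ r′ ⟨
  r′ + 0        ≡⟨ fromBool-does⁻ (r′ + 0 ≟ c′ + toℕ j) one-in-row ⟩
  c′ + toℕ j    ≡⟨ cong₂ _+_ (n≤0⇒n≡0 (+-cancelʳ-≤ n c′ 0 q′)) (toℕ-fromℕ< r<n) ⟩
  r             ∎
  where
  open ≡-Reasoning
  j : Fin n
  j = fromℕ< r<n
  one-in-row : fromBool (does (r′ + 0 ≟ c′ + toℕ j)) ≡ 1F
  one-in-row = begin
    fromBool (does (r′ + 0 ≟ c′ + toℕ j))
      ≡⟨ lookup-factor-diagonal r′ c′ 1 n p′ q′ 0F j ⟨
    Vec.lookup (Vec.lookup (factor (diagonal m n) r′ c′ 1 n p′ q′) 0F) j
      ≡⟨ cong (λ F → Vec.lookup (Vec.lookup F 0F) j) same ⟩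
    Vec.lookup (Vec.lookup (factor (diagonal m n) r 0 1 n p ≤-refl) 0F) j
      ≡⟨ lookup-factor-diagonal r 0 1 n p ≤-refl 0F j ⟩
    fromBool (does (r + 0 ≟ toℕ j))
      ≡⟨ cong fromBool (dec-true (r + 0 ≟ toℕ j) (trans (+-identityʳ r) (sym (toℕ-fromℕ< r<n)))) ⟩
    1F ∎

diagonal-attractor-meets-row : ∀ {m n} {Γ : Positions m n} → IsAttractor (diagonal m n) Γ →
                               (i : Fin m) → toℕ i < n → ∃ λ j → T (Γ i j)
diagonal-attractor-meets-row {m} {n} {Γ} attractor i i<n
  with r′ , c′ , p′ , q′ , same , x , y , x∈Γ , r′≤x , x<r′+1 , _
       ← attractor (toℕ i) 0 1 n ≤-refl (≤-trans (s≤s z≤n) i<n) (toℕ+1≤n i) ≤-refl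
  = y , subst (λ z → T (Γ z y)) (toℕ-injective x≡i) x∈Γ
  where
  r′≡i : r′ ≡ toℕ i
  r′≡i = diagonal-row-occurs-once (toℕ i) r′ c′ (toℕ+1≤n i) p′ q′ i<n same
  x≡i : toℕ x ≡ toℕ i
  x≡i = trans (≤-antisym (m<1+n⇒m≤n (subst (toℕ x <_) (+-comm r′ 1) x<r′+1)) r′≤x) r′≡i

γ≥-diagonal : ∀ m n → γ≥ (diagonal m n) 1 1 (m ⊓ n)
γ≥-diagonal m n Γ attractor = begin
  1 * (m ⊓ n) ≡⟨ *-identityˡ (m ⊓ n) ⟩
  m ⊓ n       ≤⟨ occupied-rows≤size Γ (m ⊓ n) (m⊓n≤m m n) meets-row ⟩
  size Γ      ≡⟨ *-identityˡ (size Γ) ⟨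
  1 * size Γ  ∎
  where
  open ≤-Reasoning
  meets-row : ∀ i → toℕ i < m ⊓ n → ∃ λ j → T (Γ i j)
  meets-row i i<m⊓n = diagonal-attractor-meets-row attractor i (<-≤-trans i<m⊓n (m⊓n≤n m n))

proposition2 : Σ ℕ λ σ → Σ ℕ λ c → Σ ℕ λ a → Σ ℕ λ b →
    (1 ≤ c) × (1 ≤ a) × (1 ≤ b) ×
    ((m n : ℕ) → 1 ≤ m → 1 ≤ n →
      Σ (Matrix (Fin σ) m n) λ M → δ≤ M c × γ≥ M a b (m ⊓ n))
proposition2 = 2 , 3 , 1 , 1 , s≤s z≤n , ≤-refl , ≤-refl ,
  λ m n _ _ → diagonal m n , δ≤-diagonal m n , γ≥-diagonal m n
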